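{- Let $H$ be a directed graph with at least two arcs. Then $f(H)=|E(H)|$ if and only if $H$ contains no directed path of length $2$ and no directed cycle of length $2$.
   Context: Directed graphs have no loops or parallel arcs but may contain directed 2-cycles (pairs of arcs $(u,v),(v,u)$). A directed path of length 2 consists of arcs $(u,v),(v,w)$ with $u,v,w$ distinct. For a directed graph $L$, the blowup $B(L)$ replaces each vertex $v$ by a countably infinite independent set $I_v$ with all arcs from $I_a$ to $I_b$ whenever $(a,b)\in E(L)$. ${\rm disc}_H(L)$ is the minimum number of arcs that must be added to $B(L)$ to obtain a copy of $H$. $f(H,L)=\max\{|E(H)|(1-|E(L)|/|V(L)|^2),\,|E(H)|-{\rm disc}_H(L)\}$ and $f(H)=\inf_L f(H,L)$ over all directed graphs $L$ with at least one arc. -}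

module Defs where

open import Data.Nat as ℕ using (ℕ; zero; suc)
open import Data.Integer as ℤ using (ℤ; +_)
open import Data.Rational using (ℚ; _/_; 0ℚ; 1ℚ; _-_; _⊔_; _≤_; _<_; _+_; _*_)
open import Data.Fin using (Fin)
open import Data.Bool using (Bool; true; false; if_then_else_)
open import Data.List using (List; map; allFin)
open import Data.Nat.ListAction using (sum)
open import Data.Product using (Σ; _×_; _,_; proj₁; ∃-syntax)
open import Relation.Binary.PropositionalEquality using (_≡_; _≢_)
open import Function.Definitions using (Injective)

-- Parallel arcs are impossible in
-- this representation; directed 2-cycles (adj u v and adj v u) are allowed.
record Digraph : Set where
  field
    n        : ℕ
    adj      : Fin n → Fin n → Bool
    loopless : ∀ v → adj v v ≡ false
open Digraph public

Arc : (G : Digraph) → Fin (n G) → Fin (n G) → Set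
Arc G u v = adj G u v ≡ true

countPairs : (k : ℕ) → (Fin k → Fin k → Bool) → ℕ
countPairs k p = sum (map (λ u → sum (map (λ v → if p u v then 1 else 0) (allFin k))) (allFin k))

arcs : Digraph → ℕ
arcs G = countPairs (n G) (adj G)

HasArc : Digraph → Set
HasArc G = Σ (Fin (n G)) λ u → Σ (Fin (n G)) λ v → Arc G u v

-- The blowup B(L) has vertex set V(L) × ℕ (vertex (a , i) is the i-th
-- vertex of the independent set I_a), with an arc (a , i) → (b , j)
-- iff (a , b) ∈ E(L).
BVertex : Digraph → Set
BVertex L = Fin (n L) × ℕ

BArc : (L : Digraph) → BVertex L → BVertex L → Bool
BArc L x y = adj L (proj₁ x) (proj₁ y)

-- Given an injective placement φ of V(H) into V(B(L)), the number of arcs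
-- that must be added to B(L) so that φ becomes an embedding of H
-- (as a subgraph): the arcs of H whose image is not an arc of B(L).
missing : (H L : Digraph) → (Fin (n H) → BVertex L) → ℕ
missing H L φ = countPairs (n H) (λ u v → if adj H u v then (if BArc L (φ u) (φ v) then false else true) else false)

Disc : (H L : Digraph) → ℕ → Set
Disc H L d =
  (Σ (Fin (n H) → BVertex L) λ φ → Injective _≡_ _≡_ φ × missing H L φ ≡ d)
  × (∀ (φ : Fin (n H) → BVertex L) → Injective _≡_ _≡_ φ → d ℕ.≤ missing H L φ)

-- a / b as a rational (b = 0 never occurs below, since L has an arc)
frac : ℕ → ℕ → ℚ
frac a zero    = 0ℚ
frac a (suc b) = (+ a) / suc b

ℕtoℚ : ℕ → ℚ
ℕtoℚ a = (+ a) / 1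

fVal : (H L : Digraph) → ℕ → ℚ
fVal H L d =
  (ℕtoℚ (arcs H) * (1ℚ - frac (arcs L) (n L ℕ.* n L)))
  ⊔ (ℕtoℚ (arcs H) - ℕtoℚ d)

FHL : (H L : Digraph) → ℚ → Set
FHL H L q = Σ ℕ λ d → Disc H L d × q ≡ fVal H L d

FIs : Digraph → ℚ → Set
FIs H c =
  (∀ (L : Digraph) → HasArc L → ∀ q → FHL H L q → c ≤ q)
  × (∀ (ε : ℚ) → 0ℚ < ε →
       Σ Digraph λ L → HasArc L × Σ ℚ λ q → FHL H L q × q < c + ε)

HasP2 : Digraph → Set
HasP2 H = Σ (Fin (n H)) λ u → Σ (Fin (n H)) λ v → Σ (Fin (n H)) λ w →
  Arc H u v × Arc H v w × u ≢ v × v ≢ w × u ≢ w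

HasC2 : Digraph → Set
HasC2 H = Σ (Fin (n H)) λ u → Σ (Fin (n H)) λ v →
  Arc H u v × Arc H v u × u ≢ v

-- Both directions run through the one-arc digraph K₂.  The first term of
-- f(H, K₂) is (3/4)|E(H)| < |E(H)|, so f(H) = |E(H)| forces disc_H(K₂) = 0,
-- i.e. a homomorphism H → K₂; then no vertex of H has both an in-arc and
-- an out-arc, which is exactly the absence of directed 2-paths and 2-cycles.
-- Conversely, if every vertex is a source or a sink, sending sources to the
-- tail and sinks to the head of any arc of L embeds H into B(L), so
-- disc_H(L) = 0 and f(H, L) ≥ |E(H)| for every L, with equality at L = K₂.
module Submission where

open import Defs
open import Data.Nat using (_≤_)
open import Data.Product using (_×_)
open import Function.Bundles using (_⇔_)
open import Relation.Nullary using (¬_)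

open import Data.Bool using (Bool; true; false; if_then_else_)
import Data.Bool as Bool
open import Data.Empty using (⊥-elim)
open import Data.Fin as Fin using (Fin; zero; suc; toℕ)
import Data.Fin.Properties as Fin
open import Data.List using ([]; _∷_; map; allFin)
open import Data.List.Membership.Propositional using (_∈_)
open import Data.List.Membership.Propositional.Properties using (∈-allFin)
open import Data.List.Relation.Unary.Any using (here; there)
open import Data.Nat as ℕ using (ℕ; z≤n; s≤s)
import Data.Nat.Properties as ℕ
open import Data.Nat.Induction using (<-rec)
open import Data.Nat.ListAction using (sum)
open import Data.Product using (Σ; _,_; proj₁; proj₂)
open import Data.Rational as ℚ using (ℚ; 0ℚ; 1ℚ; _-_; _⊔_; _+_; _*_; _<_; Positive)
import Data.Rational.Properties as ℚ
open import Data.Sum using ([_,_]′)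
open import Function using (_∘_)
open import Function.Bundles using (Equivalence; mk⇔)
open import Function.Definitions using (Injective)
open import Relation.Binary.PropositionalEquality using (_≡_; _≢_; refl; sym; trans; cong; subst; module ≡-Reasoning)
open import Relation.Nullary using (Dec; yes; no; does)
open import Relation.Nullary.Decidable using (toWitness)

sum-map-≡0 : ∀ {A : Set} (f : A → ℕ) xs → (∀ x → f x ≡ 0) → sum (map f xs) ≡ 0
sum-map-≡0 f []       f≡0 = refl
sum-map-≡0 f (x ∷ xs) f≡0 rewrite f≡0 x = sum-map-≡0 f xs f≡0

sum-map-≡0⇒∈⇒≡0 : ∀ {A : Set} (f : A → ℕ) {xs x} → sum (map f xs) ≡ 0 → x ∈ xs → f x ≡ 0
sum-map-≡0⇒∈⇒≡0 f s≡0 (here refl)          = ℕ.m+n≡0⇒m≡0 _ s≡0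
sum-map-≡0⇒∈⇒≡0 f {y ∷ _} s≡0 (there x∈xs) = sum-map-≡0⇒∈⇒≡0 f (ℕ.m+n≡0⇒n≡0 (f y) s≡0) x∈xs

indicator : Bool → ℕ
indicator b = if b then 1 else 0

indicator-≡0 : ∀ {b} → indicator b ≡ 0 → b ≡ false
indicator-≡0 {false} _ = refl

countPairs-≡0⇔ : ∀ k (p : Fin k → Fin k → Bool) → countPairs k p ≡ 0 ⇔ (∀ u v → p u v ≡ false)
countPairs-≡0⇔ k p = mk⇔
  (λ c≡0 u v → indicator-≡0
    (sum-map-≡0⇒∈⇒≡0 _ (sum-map-≡0⇒∈⇒≡0 _ c≡0 (∈-allFin u)) (∈-allFin v)))
  (λ p≡false → sum-map-≡0 _ (allFin k) λ u → sum-map-≡0 _ (allFin k) λ v →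
    cong indicator (p≡false u v))

IsHom : (H L : Digraph) → (Fin (n H) → Fin (n L)) → Set
IsHom H L c = ∀ {u v} → Arc H u v → Arc L (c u) (c v)

column : ∀ H L → (Fin (n H) → Fin (n L)) → Fin (n H) → BVertex L
column H L c v = c v , toℕ v

column-injective : ∀ H L c → Injective _≡_ _≡_ (column H L c)
column-injective H L c = Fin.toℕ-injective ∘ cong proj₂

isMissing-≡false⇔ : ∀ a b → (if a then (if b then false else true) else false) ≡ false ⇔ (a ≡ true → b ≡ true)
isMissing-≡false⇔ false b     = mk⇔ (λ _ ()) (λ _ → refl)
isMissing-≡false⇔ true  true  = mk⇔ (λ _ _ → refl) (λ _ → refl)
isMissing-≡false⇔ true  false = mk⇔ (λ ()) (λ b → sym (b refl))

missing-≡0⇔IsHom : ∀ H L (φ : Fin (n H) → BVertex L) → missing H L φ ≡ 0 ⇔ IsHom H L (proj₁ ∘ φ)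
missing-≡0⇔IsHom H L φ = mk⇔
  (λ m≡0 {u} {v} → Equivalence.to (isMissing-≡false⇔ _ _) (Equivalence.to counted m≡0 u v))
  (λ hom → Equivalence.from counted λ u v → Equivalence.from (isMissing-≡false⇔ _ _) hom)
  where
  counted : missing H L φ ≡ 0 ⇔
    (∀ u v → (if adj H u v then (if BArc L (φ u) (φ v) then false else true) else false) ≡ false)
  counted = countPairs-≡0⇔ _ _

IsHom⇒Disc0 : ∀ H L {c} → IsHom H L c → Disc H L 0
IsHom⇒Disc0 H L {c} hom = (column H L c , column-injective H L c , missing≡0) , λ _ _ → z≤n
  where
  missing≡0 : missing H L (column H L c) ≡ 0
  missing≡0 = Equivalence.from (missing-≡0⇔IsHom H L (column H L c)) hom

IsHom⇒Disc⇒≡0 : ∀ H L {c d} → IsHom H L c → Disc H L d → d ≡ 0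
IsHom⇒Disc⇒≡0 H L {c} hom (_ , minimal) = ℕ.n≤0⇒n≡0
  (subst (_ ℕ.≤_) (Equivalence.from (missing-≡0⇔IsHom H L (column H L c)) hom)
    (minimal _ (column-injective H L c)))

Disc0⇒IsHom : ∀ H L → Disc H L 0 → Σ (Fin (n H) → Fin (n L)) (IsHom H L)
Disc0⇒IsHom H L ((φ , _ , m≡0) , _) = proj₁ ∘ φ , Equivalence.to (missing-≡0⇔IsHom H L φ) m≡0

Minimum : (ℕ → Set) → Set
Minimum P = Σ ℕ λ d → P d × (∀ m → P m → d ℕ.≤ m)

-- The minimum of an arbitrary predicate on ℕ exists only classically; its
-- double negation suffices because we only ever use it to refute things.
¬¬-minimum : ∀ {P : ℕ → Set} k → P k → ¬ ¬ Minimum P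
¬¬-minimum {P} = <-rec (λ k → P k → ¬ ¬ Minimum P) λ k below pk noMinimum →
  noMinimum (k , pk , λ m pm → ℕ.≮⇒≥ λ m<k → below m<k pm noMinimum)

Copy : (H L : Digraph) → ℕ → Set
Copy H L d = Σ (Fin (n H) → BVertex L) λ φ → Injective _≡_ _≡_ φ × missing H L φ ≡ d

¬¬-Disc : ∀ H L → Fin (n L) → ¬ ¬ Σ ℕ (Disc H L)
¬¬-Disc H L a noDisc =
  ¬¬-minimum {Copy H L} _ (column H L (λ _ → a) , column-injective H L _ , refl) λ (d , copy , minimal) →
    noDisc (d , copy , λ φ φ-injective → minimal _ (φ , φ-injective , refl))

SourceOrSink : Digraph → Set
SourceOrSink H = ∀ {u v w} → Arc H u v → ¬ Arc H v w

Arc⇒≢ : ∀ H {u v} → Arc H u v → u ≢ v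
Arc⇒≢ H {u} uv refl with trans (sym uv) (loopless H u)
... | ()

¬HasP2×¬HasC2⇒SourceOrSink : ∀ H → ¬ HasP2 H → ¬ HasC2 H → SourceOrSink H
¬HasP2×¬HasC2⇒SourceOrSink H noP2 noC2 {u} {v} {w} uv vw with u Fin.≟ w
... | yes refl = noC2 (u , v , uv , vw , Arc⇒≢ H uv)
... | no u≢w   = noP2 (u , v , w , uv , vw , Arc⇒≢ H uv , Arc⇒≢ H vw , u≢w)

SourceOrSink⇒¬HasP2 : ∀ H → SourceOrSink H → ¬ HasP2 H
SourceOrSink⇒¬HasP2 H sourceOrSink (_ , _ , _ , uv , vw , _) = sourceOrSink uv vw

SourceOrSink⇒¬HasC2 : ∀ H → SourceOrSink H → ¬ HasC2 H
SourceOrSink⇒¬HasC2 H sourceOrSink (_ , _ , uv , vu , _) = sourceOrSink uv vu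

SourceOrSink⇒IsHom : ∀ H L → SourceOrSink H → HasArc L → Σ (Fin (n H) → Fin (n L)) (IsHom H L)
SourceOrSink⇒IsHom H L sourceOrSink (a , b , ab) = colour , isHom
  where
  hasOutArc? : ∀ v → Dec (Σ (Fin (n H)) (Arc H v))
  hasOutArc? v = Fin.any? λ w → adj H v w Bool.≟ true

  colour : Fin (n H) → Fin (n L)
  colour v = if does (hasOutArc? v) then a else b

  isHom : IsHom H L colour
  isHom {u} {v} uv with hasOutArc? u | hasOutArc? v
  ... | no noOut | _             = ⊥-elim (noOut (v , uv))
  ... | yes _    | yes (w , vw)  = ⊥-elim (sourceOrSink uv vw)
  ... | yes _    | no _          = ab

k2 : Fin 2 → Fin 2 → Bool
k2 zero zero       = false
k2 zero (suc zero) = true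
k2 (suc zero) _    = false

K2 : Digraph
K2 = record { n = 2 ; adj = k2 ; loopless = λ { zero → refl ; (suc zero) → refl } }

K2-hasArc : HasArc K2
K2-hasArc = zero , suc zero , refl

IsHom-K2⇒SourceOrSink : ∀ H {c} → IsHom H K2 c → SourceOrSink H
IsHom-K2⇒SourceOrSink H isHom uv vw = noTwoStep (isHom uv) (isHom vw)
  where
  noTwoStep : ∀ {a b d} → Arc K2 a b → ¬ Arc K2 b d
  noTwoStep {zero} {zero} ()
  noTwoStep {zero} {suc zero} _ ()
  noTwoStep {suc zero} ()

ℕtoℚ-positive : ∀ {m} → 1 ≤ m → Positive (ℕtoℚ m)
ℕtoℚ-positive {ℕ.suc m} _ = ℚ.normalize-pos (ℕ.suc m) 1

p<p+q : ∀ p {q} → 0ℚ < q → p < p + q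
p<p+q p 0<q = subst (_< p + _) (ℚ.+-identityʳ p) (ℚ.+-monoʳ-< p 0<q)

p-q<p : ∀ p q → .{{Positive q}} → p - q < p
p-q<p p q = subst (p - q <_) (ℚ.+-identityʳ p) (ℚ.+-monoʳ-< p (ℚ.neg-antimono-< (ℚ.positive⁻¹ q)))

⊔-< : ∀ {p q r} → p < r → q < r → p ⊔ q < r
⊔-< {p} {q} p<r q<r = [ (λ p⊔q≡p → subst (_< _) (sym p⊔q≡p) p<r)
                      , (λ p⊔q≡q → subst (_< _) (sym p⊔q≡q) q<r) ]′ (ℚ.⊔-sel p q)

K2-density-term< : ∀ e → 1 ≤ e → ℕtoℚ e * (1ℚ - frac (arcs K2) (n K2 ℕ.* n K2)) < ℕtoℚ e
K2-density-term< e e≥1 = subst (ℕtoℚ e * _ <_) (ℚ.*-identityʳ (ℕtoℚ e))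
  (ℚ.*-monoʳ-<-pos (ℕtoℚ e) {{ℕtoℚ-positive e≥1}} threeQuarters<1)
  where
  threeQuarters<1 : 1ℚ - frac 1 4 < 1ℚ
  threeQuarters<1 = toWitness {a? = 1ℚ - frac 1 4 ℚ.<? 1ℚ} _

fVal-K2<arcs : ∀ H {d} → 1 ≤ arcs H → 1 ≤ d → fVal H K2 d < ℕtoℚ (arcs H)
fVal-K2<arcs H {d} e≥1 d≥1 =
  ⊔-< (K2-density-term< (arcs H) e≥1) (p-q<p (ℕtoℚ (arcs H)) (ℕtoℚ d) {{ℕtoℚ-positive d≥1}})

fVal-K2-0 : ∀ H → 1 ≤ arcs H → fVal H K2 0 ≡ ℕtoℚ (arcs H)
fVal-K2-0 H e≥1 = begin
  fVal H K2 0             ≡⟨ ℚ.p≤q⇒p⊔q≡q densityTerm≤ ⟩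
  ℕtoℚ (arcs H) - ℕtoℚ 0  ≡⟨ e-0≡e ⟩
  ℕtoℚ (arcs H)           ∎
  where
  open ≡-Reasoning
  e-0≡e : ℕtoℚ (arcs H) - ℕtoℚ 0 ≡ ℕtoℚ (arcs H)
  e-0≡e = ℚ.+-identityʳ (ℕtoℚ (arcs H))
  densityTerm : ℚ
  densityTerm = ℕtoℚ (arcs H) * (1ℚ - frac (arcs K2) (n K2 ℕ.* n K2))
  densityTerm≤ : densityTerm ℚ.≤ ℕtoℚ (arcs H) - ℕtoℚ 0
  densityTerm≤ = ℚ.<⇒≤ (subst (densityTerm <_) (sym e-0≡e) (K2-density-term< (arcs H) e≥1))

arcs≤fVal0 : ∀ H L → ℕtoℚ (arcs H) ℚ.≤ fVal H L 0
arcs≤fVal0 H L = ℚ.p≤q⇒p≤r⊔q (ℕtoℚ (arcs H) * (1ℚ - frac (arcs L) (n L ℕ.* n L)))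
  (ℚ.≤-reflexive (sym (ℚ.+-identityʳ (ℕtoℚ (arcs H)))))

FIs⇒Disc-K2≡0 : ∀ H → 1 ≤ arcs H → FIs H (ℕtoℚ (arcs H)) → ∀ {d} → Disc H K2 d → d ≡ 0
FIs⇒Disc-K2≡0 H e≥1 fIs {ℕ.zero}  disc = refl
FIs⇒Disc-K2≡0 H e≥1 fIs {ℕ.suc d} disc =
  ⊥-elim (ℚ.<-irrefl refl (ℚ.≤-<-trans e≤f (fVal-K2<arcs H {ℕ.suc d} e≥1 (s≤s z≤n))))
  where
  e≤f : ℕtoℚ (arcs H) ℚ.≤ fVal H K2 (ℕ.suc d)
  e≤f = proj₁ fIs K2 K2-hasArc _ (ℕ.suc d , disc , refl)

FIs⇒SourceOrSink : ∀ H → 1 ≤ arcs H → FIs H (ℕtoℚ (arcs H)) → SourceOrSink H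
FIs⇒SourceOrSink H e≥1 fIs uv vw = ¬¬-Disc H K2 zero λ (d , disc) →
  let disc0 = subst (Disc H K2) (FIs⇒Disc-K2≡0 H e≥1 fIs disc) disc
  in IsHom-K2⇒SourceOrSink H (proj₂ (Disc0⇒IsHom H K2 disc0)) uv vw

SourceOrSink⇒FIs : ∀ H → 1 ≤ arcs H → SourceOrSink H → FIs H (ℕtoℚ (arcs H))
SourceOrSink⇒FIs H e≥1 sourceOrSink = lowerBound , attained
  where
  hom : ∀ L → HasArc L → Σ (Fin (n H) → Fin (n L)) (IsHom H L)
  hom L = SourceOrSink⇒IsHom H L sourceOrSink

  lowerBound : ∀ L → HasArc L → ∀ q → FHL H L q → ℕtoℚ (arcs H) ℚ.≤ q
  lowerBound L hasArc _ (d , disc , refl) =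
    subst (λ d → ℕtoℚ (arcs H) ℚ.≤ fVal H L d) (sym (IsHom⇒Disc⇒≡0 H L (proj₂ (hom L hasArc)) disc))
      (arcs≤fVal0 H L)

  attained : ∀ ε → 0ℚ < ε → Σ Digraph λ L → HasArc L × Σ ℚ λ q → FHL H L q × q < ℕtoℚ (arcs H) + ε
  attained ε ε>0 =
    K2 , K2-hasArc , ℕtoℚ (arcs H) ,
    (0 , IsHom⇒Disc0 H K2 (proj₂ (hom K2 K2-hasArc)) , sym (fVal-K2-0 H e≥1)) , p<p+q _ ε>0

proposition3p1 : (H : Digraph) → 2 ≤ arcs H →
    FIs H (ℕtoℚ (arcs H)) ⇔ (¬ HasP2 H × ¬ HasC2 H)
proposition3p1 H e≥2 = mk⇔
  (λ fIs → let sourceOrSink = FIs⇒SourceOrSink H e≥1 fIs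
           in SourceOrSink⇒¬HasP2 H sourceOrSink , SourceOrSink⇒¬HasC2 H sourceOrSink)
  (λ (noP2 , noC2) → SourceOrSink⇒FIs H e≥1 (¬HasP2×¬HasC2⇒SourceOrSink H noP2 noC2))
  where
  e≥1 : 1 ≤ arcs H
  e≥1 = ℕ.<⇒≤ e≥2
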